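{- Suppose $m$ and $n$ are both even positive integers. Then $\mathsf{DL}(L_{m,n}) \leq (m+n)/2 - 1$.
   Context: $L_{m,n}$ is the $m\times n$ grid graph, i.e. the Cartesian product of a path on $m$ vertices and a path on $n$ vertices (vertices $(i,j)$, $1\le i\le m$, $1\le j\le n$, with $(i,j)\sim(i',j')$ iff $|i-i'|+|j-j'|=1$). For a finite connected graph $G=(V,E)$ with $|V|=N$ and graph distance $d$, a $k$-dispersed labelling is a bijection $\phi:\{1,\dots,N\}\to V$ with $d(\phi(i),\phi(i+1))\ge k$ for $1\le i\le N-1$; $\mathsf{DL}(G)$ is the maximum such $k$. -}

module Defs where

open import Data.Nat using (ℕ; zero; suc; _+_; _*_; _≤_; _<_)
open import Data.Fin using (Fin; toℕ)
open import Data.Product using (_×_; _,_; Σ)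
open import Relation.Binary.PropositionalEquality using (_≡_)
open import Function.Bundles using (_⤖_; Bijection)

GridV : ℕ → ℕ → Set
GridV m n = Fin m × Fin n

data GridAdj {m n : ℕ} : GridV m n → GridV m n → Set where
  right : ∀ {i j j'} → suc (toℕ j) ≡ toℕ j' → GridAdj (i , j) (i , j')
  left  : ∀ {i j j'} → toℕ j ≡ suc (toℕ j') → GridAdj (i , j) (i , j')
  down  : ∀ {i i' j} → suc (toℕ i) ≡ toℕ i' → GridAdj (i , j) (i' , j)
  up    : ∀ {i i' j} → toℕ i ≡ suc (toℕ i') → GridAdj (i , j) (i' , j)

data Walk {m n : ℕ} : GridV m n → GridV m n → ℕ → Set where
  here : ∀ {u} → Walk u u zero
  step : ∀ {u v w ℓ} → GridAdj u v → Walk v w ℓ → Walk u w (suc ℓ)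

DistGE : ∀ {m n} → GridV m n → GridV m n → ℕ → Set
DistGE u v k = ∀ ℓ → ℓ < k → Walk u v ℓ → Data.Empty.⊥
  where import Data.Empty

-- A k-dispersed labelling of L_{m,n}: a bijection φ from the label set
-- {1,…,mn} (here Fin (m*n), labels shifted to 0-indexed) to the vertices,
-- with d(φ(i),φ(i+1)) ≥ k for all consecutive labels.
IsDispersed : (m n k : ℕ) → (Fin (m * n) → GridV m n) → Set
IsDispersed m n k φ =
  ∀ (i : Fin (m * n)) (i' : Fin (m * n)) → suc (toℕ i) ≡ toℕ i' → DistGE (φ i) (φ i') k

DispersedLabelling : (m n k : ℕ) → Set
DispersedLabelling m n k =
  Σ (Fin (m * n) ⤖ GridV m n) λ φ → IsDispersed m n k (Bijection.to φ)

-- DL(L_{m,n}) ≤ K : no (K+1)-dispersed labelling exists (dispersedness is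
-- monotone in k, so the maximum k is ≤ K iff no (K+1)-dispersed labelling).
DL≤ : (m n K : ℕ) → Set
DL≤ m n K = DispersedLabelling m n (suc K) → Data.Empty.⊥
  where import Data.Empty

-- Write m = 2a and n = 2b and suppose a labelling is (a + b)-dispersed.  In a line of
-- even length 2a each of the two middle points is at distance at most a from every
-- point, with equality only at the opposite end; hence each of the four central
-- vertices of the grid has exactly one vertex at distance ≥ a + b.  A vertex whose
-- label has both a predecessor and a successor needs two distinct such vertices, so
-- every central vertex carries the first or the last label, which is impossible for
-- three of them.
module Submission where

open import Defs
open import Data.Nat using (ℕ; _+_; _∸_; _/_; _<_)
open import Data.Nat.Divisibility using (_∣_)

open import Data.Nat using (zero; suc; _*_; _≤_; s≤s; s≤s⁻¹; ∣_-_∣; _<?_)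
open import Data.Nat.Properties
open import Data.Nat.DivMod using (m*n/n≡m)
open import Data.Nat.Divisibility using (divides)
open import Data.Fin using (Fin; toℕ; fromℕ<; inject₁) renaming (zero to fzero; suc to fsuc)
open import Data.Fin.Properties using (toℕ-fromℕ<; toℕ-injective; toℕ<n; toℕ-inject₁)
open import Data.Product using (_×_; _,_; ∃; proj₁; proj₂)
open import Data.Sum using (_⊎_; inj₁; inj₂)
import Data.Sum as Sum
open import Data.Empty using (⊥-elim)
open import Relation.Nullary using (¬_; yes; no)
open import Relation.Binary.PropositionalEquality
  using (_≡_; _≢_; refl; sym; trans; cong; cong₂; subst; subst₂; module ≡-Reasoning)
open import Function.Bundles using (Bijection)

module _ {m n : ℕ} where

  GridAdj-sym : {u v : GridV m n} → GridAdj u v → GridAdj v u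
  GridAdj-sym (right e) = left (sym e)
  GridAdj-sym (left e)  = right (sym e)
  GridAdj-sym (down e)  = up (sym e)
  GridAdj-sym (up e)    = down (sym e)

  append : {u v w : GridV m n} {ℓ ℓ′ : ℕ} → Walk u v ℓ → Walk v w ℓ′ → Walk u w (ℓ + ℓ′)
  append here       q = q
  append (step e p) q = step e (append p q)

  reverse : {u v : GridV m n} {ℓ : ℕ} → Walk u v ℓ → Walk v u ℓ
  reverse here = here
  reverse {ℓ = suc ℓ} (step e p) =
    subst (Walk _ _) (+-comm ℓ 1) (append (reverse p) (step (GridAdj-sym e) here))

  module _ {p : ℕ} (line : Fin p → GridV m n)
           (adjacent : {x y : Fin p} → suc (toℕ x) ≡ toℕ y → GridAdj (line x) (line y)) where

    ascending-walk : ∀ d {x y : Fin p} → toℕ y ≡ d + toℕ x → Walk (line x) (line y) d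
    ascending-walk zero y≡x with toℕ-injective y≡x
    ... | refl = here
    ascending-walk (suc d) {x} {y} y≡ =
      step (adjacent (sym (toℕ-fromℕ< x+1<p))) (ascending-walk d y≡′)
      where
      x+1<p : suc (toℕ x) < p
      x+1<p = ≤-<-trans (s≤s (m≤n+m (toℕ x) d)) (subst (_< p) y≡ (toℕ<n y))
      y≡′ : toℕ y ≡ d + toℕ (fromℕ< x+1<p)
      y≡′ = begin
        toℕ y                       ≡⟨ y≡ ⟩
        suc (d + toℕ x)             ≡⟨ +-suc d (toℕ x) ⟨
        d + suc (toℕ x)             ≡⟨ cong (d +_) (toℕ-fromℕ< x+1<p) ⟨
        d + toℕ (fromℕ< x+1<p)      ∎
        where open ≡-Reasoning

    line-walk : ∀ x y → Walk (line x) (line y) ∣ toℕ x - toℕ y ∣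
    line-walk x y with ≤-total (toℕ x) (toℕ y)
    ... | inj₁ x≤y rewrite m≤n⇒∣m-n∣≡n∸m x≤y = ascending-walk _ (sym (m∸n+n≡m x≤y))
    ... | inj₂ y≤x rewrite m≤n⇒∣n-m∣≡n∸m y≤x = reverse (ascending-walk _ (sym (m∸n+n≡m y≤x)))

  dist : GridV m n → GridV m n → ℕ
  dist (i , j) (i′ , j′) = ∣ toℕ i - toℕ i′ ∣ + ∣ toℕ j - toℕ j′ ∣

  dist-comm : ∀ u v → dist u v ≡ dist v u
  dist-comm (i , j) (i′ , j′) = cong₂ _+_ (∣-∣-comm (toℕ i) (toℕ i′)) (∣-∣-comm (toℕ j) (toℕ j′))

  dist-walk : ∀ u v → Walk u v (dist u v)
  dist-walk (i , j) (i′ , j′) = append (line-walk (_, j) down i i′) (line-walk (i′ ,_) right j j′)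

  DistGE⇒≤dist : ∀ {u v k} → DistGE u v k → k ≤ dist u v
  DistGE⇒≤dist {u} {v} far = ≮⇒≥ (λ short → far _ short (dist-walk u v))

  UniqueFar : ℕ → GridV m n → Set
  UniqueFar k c = ∀ {v w} → k ≤ dist c v → k ≤ dist c w → v ≡ w

  UniqueFar-mono : ∀ {k k′ c} → k ≤ k′ → UniqueFar k c → UniqueFar k′ c
  UniqueFar-mono k≤k′ unique far-v far-w = unique (≤-trans k≤k′ far-v) (≤-trans k≤k′ far-w)

record LineCentre (p c r t : ℕ) : Set where
  field
    ∣c-x∣≤r   : ∀ {x} → x < p → ∣ c - x ∣ ≤ r
    r≤∣c-x∣⇒t : ∀ {x} → x < p → r ≤ ∣ c - x ∣ → x ≡ t

∣c-x∣≤ : ∀ {c d r x} → x ≤ c + d → c ≤ r → d ≤ r → ∣ c - x ∣ ≤ r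
∣c-x∣≤ {c} {d} {r} {x} x≤c+d c≤r d≤r with ≤-total x c
... | inj₁ x≤c rewrite m≤n⇒∣n-m∣≡n∸m x≤c = ≤-trans (m∸n≤m c x) c≤r
... | inj₂ c≤x rewrite m≤n⇒∣m-n∣≡n∸m c≤x = ≤-trans (m≤n+o⇒m∸n≤o x c x≤c+d) d≤r

centre-left : ∀ {p c d} → c < d → p ≡ suc (c + d) → LineCentre p c d (c + d)
centre-left {c = c} {d} c<d refl = record
  { ∣c-x∣≤r   = λ x<p → ∣c-x∣≤ (s≤s⁻¹ x<p) (<⇒≤ c<d) ≤-refl
  ; r≤∣c-x∣⇒t = λ x<p → far (s≤s⁻¹ x<p)
  }
  where
  far : ∀ {x} → x ≤ c + d → d ≤ ∣ c - x ∣ → x ≡ c + d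
  far {x} x≤c+d d≤ with ≤-total x c
  ... | inj₁ x≤c rewrite m≤n⇒∣n-m∣≡n∸m x≤c = ⊥-elim (<⇒≱ c<d (≤-trans d≤ (m∸n≤m c x)))
  ... | inj₂ c≤x rewrite m≤n⇒∣m-n∣≡n∸m c≤x =
    ≤-antisym x≤c+d (subst (_≤ x) (+-comm d c) (m≤o∸n⇒m+n≤o d c≤x d≤))

centre-right : ∀ {p c d} → d < c → p ≡ suc (c + d) → LineCentre p c c 0
centre-right {c = c} {d} d<c refl = record
  { ∣c-x∣≤r   = λ x<p → ∣c-x∣≤ (s≤s⁻¹ x<p) ≤-refl (<⇒≤ d<c)
  ; r≤∣c-x∣⇒t = λ x<p → far (s≤s⁻¹ x<p)
  }
  where
  far : ∀ {x} → x ≤ c + d → c ≤ ∣ c - x ∣ → x ≡ 0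
  far {x} x≤c+d c≤ with ≤-total x c
  ... | inj₁ x≤c rewrite m≤n⇒∣n-m∣≡n∸m x≤c =
    n≤0⇒n≡0 (+-cancelˡ-≤ c x 0 (subst (c + x ≤_) (sym (+-identityʳ c)) (m≤o∸n⇒m+n≤o c x≤c c≤)))
  ... | inj₂ c≤x rewrite m≤n⇒∣m-n∣≡n∸m c≤x =
    ⊥-elim (<⇒≱ d<c (≤-trans c≤ (m≤n+o⇒m∸n≤o x c x≤c+d)))

+-tight : ∀ {x y r s} → x ≤ r → y ≤ s → r + s ≤ x + y → r ≤ x × s ≤ y
+-tight x≤r y≤s r+s≤ =
  ≮⇒≥ (λ x<r → <⇒≱ (+-mono-<-≤ x<r y≤s) r+s≤) , ≮⇒≥ (λ y<s → <⇒≱ (+-mono-≤-< x≤r y<s) r+s≤)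

centre-uniqueFar : ∀ {m n r s t u} {c₁ : Fin m} {c₂ : Fin n} →
  LineCentre m (toℕ c₁) r t → LineCentre n (toℕ c₂) s u → UniqueFar (r + s) (c₁ , c₂)
centre-uniqueFar {r = r} {s} {t} {u} {c₁} {c₂} C D far-v far-w =
  cong₂ _,_ (toℕ-injective (trans (proj₁ (antipodal far-v)) (sym (proj₁ (antipodal far-w)))))
            (toℕ-injective (trans (proj₂ (antipodal far-v)) (sym (proj₂ (antipodal far-w)))))
  where
  open LineCentre
  antipodal : ∀ {v} → r + s ≤ dist (c₁ , c₂) v → toℕ (proj₁ v) ≡ t × toℕ (proj₂ v) ≡ u
  antipodal {v₁ , v₂} far =
    let r≤ , s≤ = +-tight (∣c-x∣≤r C (toℕ<n v₁)) (∣c-x∣≤r D (toℕ<n v₂)) far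
    in r≤∣c-x∣⇒t C (toℕ<n v₁) r≤ , r≤∣c-x∣⇒t D (toℕ<n v₂) s≤

Interior : ∀ {N} → Fin N → Set
Interior {N} i = (∃ λ (h : Fin N) → suc (toℕ h) ≡ toℕ i) × (∃ λ (j : Fin N) → suc (toℕ i) ≡ toℕ j)

Endpoint : ∀ {N} → Fin N → Set
Endpoint {N} i = toℕ i ≡ 0 ⊎ suc (toℕ i) ≡ N

interior-or-endpoint : ∀ {N} (i : Fin N) → Interior i ⊎ Endpoint i
interior-or-endpoint fzero = inj₂ (inj₁ refl)
interior-or-endpoint {N} i@(fsuc h) with suc (toℕ i) <? N
... | yes i+1<N = inj₁ ((inject₁ h , cong suc (toℕ-inject₁ h)) , (fromℕ< i+1<N , sym (toℕ-fromℕ< i+1<N)))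
... | no  i+1≮N = inj₂ (inj₂ (≤-antisym (toℕ<n i) (≮⇒≥ i+1≮N)))

endpoints-collide : ∀ {N} {i j l : Fin N} → Endpoint i → Endpoint j → Endpoint l →
  i ≡ j ⊎ i ≡ l ⊎ j ≡ l
endpoints-collide {N} = collide
  where
  first : {x y : Fin N} → toℕ x ≡ 0 → toℕ y ≡ 0 → x ≡ y
  first x≡0 y≡0 = toℕ-injective (trans x≡0 (sym y≡0))
  last : {x y : Fin N} → suc (toℕ x) ≡ N → suc (toℕ y) ≡ N → x ≡ y
  last x-last y-last = toℕ-injective (suc-injective (trans x-last (sym y-last)))
  collide : ∀ {i j l} → Endpoint i → Endpoint j → Endpoint l → i ≡ j ⊎ i ≡ l ⊎ j ≡ l
  collide (inj₁ x) (inj₁ y) _        = inj₁ (first x y)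
  collide (inj₂ x) (inj₂ y) _        = inj₁ (last x y)
  collide (inj₁ x) (inj₂ y) (inj₁ z) = inj₂ (inj₁ (first x z))
  collide (inj₁ x) (inj₂ y) (inj₂ z) = inj₂ (inj₂ (last y z))
  collide (inj₂ x) (inj₁ y) (inj₁ z) = inj₂ (inj₂ (first y z))
  collide (inj₂ x) (inj₁ y) (inj₂ z) = inj₂ (inj₁ (last x z))

module _ {m n k : ℕ} (labelling : DispersedLabelling m n k) where
  open Bijection (proj₁ labelling) using (to; injective; strictlySurjective)

  uniqueFar⇒endpoint : ∀ i → UniqueFar k (to i) → Endpoint i
  uniqueFar⇒endpoint i unique with interior-or-endpoint i
  ... | inj₂ endpoint = endpoint
  ... | inj₁ ((h , h→i) , (j , i→j)) = ⊥-elim (<-irrefl (cong toℕ h≡j) h<j)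
    where
    far-h : k ≤ dist (to i) (to h)
    far-h = subst (k ≤_) (dist-comm (to h) (to i)) (DistGE⇒≤dist (proj₂ labelling h i h→i))
    h≡j : h ≡ j
    h≡j = injective (unique far-h (DistGE⇒≤dist (proj₂ labelling i j i→j)))
    h<j : toℕ h < toℕ j
    h<j = subst₂ _≤_ (sym h→i) i→j (n≤1+n (toℕ i))

  at-most-two-uniqueFar : {u v w : GridV m n} →
    UniqueFar k u → UniqueFar k v → UniqueFar k w → u ≡ v ⊎ u ≡ w ⊎ v ≡ w
  at-most-two-uniqueFar {u} {v} {w} U V W =
    Sum.map label-injective (Sum.map label-injective label-injective)
      (endpoints-collide (endpoint U) (endpoint V) (endpoint W))
    where
    label : GridV m n → Fin (m * n)
    label x = proj₁ (strictlySurjective x)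
    to-label : ∀ x → to (label x) ≡ x
    to-label x = proj₂ (strictlySurjective x)
    endpoint : ∀ {x} → UniqueFar k x → Endpoint (label x)
    endpoint {x} X = uniqueFar⇒endpoint (label x) (subst (UniqueFar k) (sym (to-label x)) X)
    label-injective : ∀ {x y} → label x ≡ label y → x ≡ y
    label-injective {x} {y} e = trans (sym (to-label x)) (trans (cong to e) (to-label y))

n*2≡n+n : ∀ n → n * 2 ≡ n + n
n*2≡n+n n = trans (*-comm n 2) (cong (n +_) (+-identityʳ n))

module MiddleOfEvenLine (a : ℕ) where
  a<2a+2 : a < suc a * 2
  a<2a+2 = subst (a <_) (sym (n*2≡n+n (suc a))) (m≤m+n (suc a) (suc a))

  a+1<2a+2 : suc a < suc a * 2
  a+1<2a+2 = subst (suc a <_) (sym (n*2≡n+n (suc a))) (s≤s (m≤n+m (suc a) a))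

  lower upper : Fin (suc a * 2)
  lower = fromℕ< a<2a+2
  upper = fromℕ< a+1<2a+2

  lower≢upper : lower ≢ upper
  lower≢upper e =
    <-irrefl (trans (sym (toℕ-fromℕ< a<2a+2)) (trans (cong toℕ e) (toℕ-fromℕ< a+1<2a+2))) (n<1+n a)

  lower-centre : LineCentre (suc a * 2) (toℕ lower) (suc a) (a + suc a)
  lower-centre = subst (λ c → LineCentre (suc a * 2) c (suc a) (a + suc a)) (sym (toℕ-fromℕ< a<2a+2))
    (centre-left ≤-refl (n*2≡n+n (suc a)))

  upper-centre : LineCentre (suc a * 2) (toℕ upper) (suc a) 0
  upper-centre = subst (λ c → LineCentre (suc a * 2) c (suc a) 0) (sym (toℕ-fromℕ< a+1<2a+2))
    (centre-right ≤-refl (trans (n*2≡n+n (suc a)) (cong suc (+-suc a a))))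

m+n≤1+[m*2+n*2]/2∸1 : ∀ m n → m + n ≤ suc ((m * 2 + n * 2) / 2 ∸ 1)
m+n≤1+[m*2+n*2]/2∸1 m n = subst (λ h → m + n ≤ suc (h ∸ 1)) (sym half) (m≤n+m∸n (m + n) 1)
  where
  half : (m * 2 + n * 2) / 2 ≡ m + n
  half = trans (cong (_/ 2) (sym (*-distribʳ-+ 2 m n))) (m*n/n≡m (m + n) 2)

theorem2p6 : (m n : ℕ) → 0 < m → 0 < n → 2 ∣ m → 2 ∣ n →
    DL≤ m n ((m + n) / 2 ∸ 1)
theorem2p6 .(suc a * 2) .(suc b * 2) _ _ (divides (suc a) refl) (divides (suc b) refl) L =
  distinct (at-most-two-uniqueFar L (far c₁ lower-centre lower-centre′)
                                    (far c₂ upper-centre upper-centre′)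
                                    (far c₃ lower-centre upper-centre′))
  where
  open MiddleOfEvenLine a
  open MiddleOfEvenLine b using () renaming
    (lower to lower′; upper to upper′; lower-centre to lower-centre′;
     upper-centre to upper-centre′; lower≢upper to lower′≢upper′)
  c₁ c₂ c₃ : GridV (suc a * 2) (suc b * 2)
  c₁ = lower , lower′
  c₂ = upper , upper′
  c₃ = lower , upper′
  distinct : ¬ (c₁ ≡ c₂ ⊎ c₁ ≡ c₃ ⊎ c₂ ≡ c₃)
  distinct (inj₁ e)        = lower≢upper (cong proj₁ e)
  distinct (inj₂ (inj₁ e)) = lower′≢upper′ (cong proj₂ e)
  distinct (inj₂ (inj₂ e)) = lower≢upper (sym (cong proj₁ e))
  far : ∀ {t u} c → LineCentre (suc a * 2) (toℕ (proj₁ c)) (suc a) t →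
        LineCentre (suc b * 2) (toℕ (proj₂ c)) (suc b) u →
        UniqueFar (suc ((suc a * 2 + suc b * 2) / 2 ∸ 1)) c
  far c C D = UniqueFar-mono {c = c} (m+n≤1+[m*2+n*2]/2∸1 (suc a) (suc b)) (centre-uniqueFar C D)
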